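{- In $\mathcal{L}\mathcal{R}$-Subtraction Nim with removable set $S=\{2,3\}$, for $n\in\mathbb{Z}_{\ge0}$: $\mathcal{O}_S(n)=\mathcal{L}$ if $n\in\{5m,5m+2 : m\in\mathbb{Z}_{\ge0}\}$; $\mathcal{O}_S(n)=\mathcal{R}$ if $n=1$; $\mathcal{O}_S(n)=\mathcal{N}$ if $n\in\{5m+3,5m+4: m\in\mathbb{Z}_{\ge0}\}$; $\mathcal{O}_S(n)=\mathcal{P}$ if $n\in\{5m+1: m\in\mathbb{Z}_{\ge1}\}$.
   Context: $\mathcal{L}\mathcal{R}$-Subtraction Nim with removable set $S$ (a non-empty subset of $\mathbb{Z}_{\ge 2}$): a position is a number $n\in\mathbb{Z}_{\ge0}$ of tokens. Players Left and Right alternate moves; a move from $n$ removes $s$ tokens for some $s\in S$ with $s\le n$, leading to $n-s$. When the player to move has no move (i.e. $n<\min S$), the game ends; Left wins if the number $n$ of remaining tokens is even and Right wins if $n$ is odd (regardless of who is to move). The outcome $\mathcal{O}_S(n)$ is $\mathcal{L}$ if Left has a winning strategy from $n$ both moving first and moving second; $\mathcal{R}$ if Right has a winning strategy both moving first and moving second; $\mathcal{N}$ if the first player to move (whether Left or Right) has a winning strategy; $\mathcal{P}$ if the second player (whether Left or Right) has a winning strategy. -}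

module Defs where

open import Data.Nat using (ℕ; _+_; _*_; _≤_; _<_)
open import Data.Nat.Properties using ()
open import Data.List using (List; _∷_; [])
open import Data.List.Membership.Propositional using (_∈_)
open import Data.Product using (_×_; ∃-syntax; _,_)
open import Relation.Nullary using (¬_)
open import Relation.Binary.PropositionalEquality using (_≡_)

Even : ℕ → Set
Even n = ∃[ k ] n ≡ 2 * k

Odd : ℕ → Set
Odd n = ∃[ k ] n ≡ 2 * k + 1

Terminal : List ℕ → ℕ → Set
Terminal S n = ∀ s → s ∈ S → ¬ (s ≤ n)


-- WinL-Lmove S n : Left wins from n when Left is to move.
-- WinL-Rmove S n : Left wins from n when Right is to move.
-- (Similarly WinR-… for Right.)
mutual
  data WinL-Lmove (S : List ℕ) : ℕ → Set where
    end  : ∀ {n} → Terminal S n → Even n → WinL-Lmove S n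
    move : ∀ {n} s m → s ∈ S → m + s ≡ n → WinL-Rmove S m → WinL-Lmove S n

  data WinL-Rmove (S : List ℕ) : ℕ → Set where
    end  : ∀ {n} → Terminal S n → Even n → WinL-Rmove S n
    all  : ∀ {n} → ¬ Terminal S n →
           (∀ s m → s ∈ S → m + s ≡ n → WinL-Lmove S m) → WinL-Rmove S n

mutual
  data WinR-Rmove (S : List ℕ) : ℕ → Set where
    end  : ∀ {n} → Terminal S n → Odd n → WinR-Rmove S n
    move : ∀ {n} s m → s ∈ S → m + s ≡ n → WinR-Lmove S m → WinR-Rmove S n

  data WinR-Lmove (S : List ℕ) : ℕ → Set where
    end  : ∀ {n} → Terminal S n → Odd n → WinR-Lmove S n
    all  : ∀ {n} → ¬ Terminal S n →
           (∀ s m → s ∈ S → m + s ≡ n → WinR-Rmove S m) → WinR-Lmove S n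

data Outcome : Set where
  𝓛 𝓡 𝓝 𝓟 : Outcome

HasOutcome : List ℕ → ℕ → Outcome → Set
HasOutcome S n 𝓛 = WinL-Lmove S n × WinL-Rmove S n
HasOutcome S n 𝓡 = WinR-Rmove S n × WinR-Lmove S n
HasOutcome S n 𝓝 = WinL-Lmove S n × WinR-Rmove S n
HasOutcome S n 𝓟 = WinR-Lmove S n × WinL-Rmove S n

-- Positions below 2 are terminal, so 0 is 𝓛 and 1 is 𝓡, and the outcomes of 0,2,3,4 seed a
-- period of length 5. Going up one period, Left to move from 5+p takes 3 to reach the 𝓛-position
-- 2+p, while Right to move can only reach 3+p or 2+p, where Left (now to move) wins; similarly
-- for 7+p, 8+p, 9+p. The position 6+p is 𝓟 because both its options 4+p and 3+p are 𝓝.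
module Submission where

open import Defs
open import Data.Nat using (ℕ; zero; suc; _+_; _*_; _<_; z≤n; s≤s)
open import Data.Nat.Properties using (+-comm; +-cancelʳ-≡; *-suc; <⇒≱; ≤-trans; n≤1+n)
open import Data.List using (List; _∷_; [])
open import Data.List.Relation.Unary.Any using (here; there)
open import Data.List.Membership.Propositional using (_∈_)
open import Data.Product using (_×_; ∃-syntax; _,_; proj₁; proj₂)
open import Data.Sum using (_⊎_; inj₁; inj₂)
open import Relation.Nullary using (¬_)
open import Relation.Binary.PropositionalEquality using (_≡_; refl; sym; trans; subst)

moveL : ∀ {S s m} → s ∈ S → WinL-Rmove S m → WinL-Lmove S (s + m)
moveL {s = s} {m} s∈S = move s m s∈S (+-comm m s)

moveR : ∀ {S s m} → s ∈ S → WinR-Lmove S m → WinR-Rmove S (s + m)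
moveR {s = s} {m} s∈S = move s m s∈S (+-comm m s)

S : List ℕ
S = 2 ∷ 3 ∷ []

2∈S : 2 ∈ S
2∈S = here refl

3∈S : 3 ∈ S
3∈S = there (here refl)

terminal : ∀ {n} → n < 2 → Terminal S n
terminal n<2 .2 (here refl)         2≤n = <⇒≱ n<2 2≤n
terminal n<2 .3 (there (here refl)) 3≤n = <⇒≱ n<2 (≤-trans (n≤1+n 2) 3≤n)

nonterminal : ∀ k → ¬ Terminal S (2 + k)
nonterminal k t = t 2 2∈S (s≤s (s≤s z≤n))

options-of-2 : ∀ {P : ℕ → Set} → P 0 → ∀ s m → s ∈ S → m + s ≡ 2 → P m
options-of-2 {P} p0 .2 m (here refl) e =
  subst P (sym (+-cancelʳ-≡ 2 m 0 e)) p0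
options-of-2 p0 .3 m (there (here refl)) e with trans (+-comm 3 m) e
... | ()

options-of-3+ : ∀ {P : ℕ → Set} k → P (1 + k) → P k → ∀ s m → s ∈ S → m + s ≡ 3 + k → P m
options-of-3+ {P} k p₁ p₀ .2 m (here refl) e =
  subst P (sym (+-cancelʳ-≡ 2 m (1 + k) (trans e (+-comm 2 (1 + k))))) p₁
options-of-3+ {P} k p₁ p₀ .3 m (there (here refl)) e =
  subst P (sym (+-cancelʳ-≡ 3 m k (trans e (+-comm 3 k)))) p₀

repliesL : ∀ k → WinL-Lmove S (1 + k) → WinL-Lmove S k → WinL-Rmove S (3 + k)
repliesL k l₁ l₀ = all (nonterminal (1 + k)) (options-of-3+ k l₁ l₀)

repliesR : ∀ k → WinR-Rmove S (1 + k) → WinR-Rmove S k → WinR-Lmove S (3 + k)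
repliesR k r₁ r₀ = all (nonterminal (1 + k)) (options-of-3+ k r₁ r₀)

-- Position 1 + p is left out: it is 𝓡 for p = 0 but 𝓟 for later blocks (block-𝓟).
record Block (p : ℕ) : Set where
  constructor mkBlock
  field
    at0 : HasOutcome S p 𝓛
    at2 : HasOutcome S (2 + p) 𝓛
    at3 : HasOutcome S (3 + p) 𝓝
    at4 : HasOutcome S (4 + p) 𝓝

outcome-0 : HasOutcome S 0 𝓛
outcome-0 = end (terminal (s≤s z≤n)) (0 , refl) , end (terminal (s≤s z≤n)) (0 , refl)

outcome-1 : HasOutcome S 1 𝓡
outcome-1 = end (terminal (s≤s (s≤s z≤n))) (0 , refl) , end (terminal (s≤s (s≤s z≤n))) (0 , refl)

block-0 : Block 0
block-0 =
  mkBlock outcome-0 (moveL 2∈S lr₀ , lr₂) (moveL 3∈S lr₀ , moveR 2∈S rl₁) (moveL 2∈S lr₂ , moveR 3∈S rl₁)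
  where
  lr₀ : WinL-Rmove S 0
  lr₀ = proj₂ outcome-0
  lr₂ : WinL-Rmove S 2
  lr₂ = all (nonterminal 0) (options-of-2 (proj₁ outcome-0))
  rl₁ : WinR-Lmove S 1
  rl₁ = proj₂ outcome-1

block-𝓟 : ∀ {p} → Block p → HasOutcome S (6 + p) 𝓟
block-𝓟 {p} (mkBlock _ _ (ll₃ , rr₃) (ll₄ , rr₄)) =
  repliesR (3 + p) rr₄ rr₃ , repliesL (3 + p) ll₄ ll₃

next-block : ∀ {p} → Block p → Block (5 + p)
next-block {p} b@(mkBlock _ (ll₂ , lr₂) (ll₃ , _) (ll₄ , _)) =
  mkBlock (ll₅ , lr₅) (moveL 2∈S lr₅ , lr₇) (moveL 3∈S lr₅ , moveR 2∈S rl₆) (moveL 2∈S lr₇ , moveR 3∈S rl₆)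
  where
  ll₅ : WinL-Lmove S (5 + p)
  ll₅ = moveL 3∈S lr₂
  lr₅ : WinL-Rmove S (5 + p)
  lr₅ = repliesL (2 + p) ll₃ ll₂
  lr₇ : WinL-Rmove S (7 + p)
  lr₇ = repliesL (4 + p) ll₅ ll₄
  rl₆ : WinR-Lmove S (6 + p)
  rl₆ = proj₁ (block-𝓟 b)

block : ∀ m → Block (5 * m)
block zero    = block-0
block (suc m) = subst Block (sym (*-suc 5 m)) (next-block (block m))

offset-comm : ∀ o k p → HasOutcome S (k + p) o → HasOutcome S (p + k) o
offset-comm o k p = subst (λ n → HasOutcome S n o) (+-comm k p)

proposition3 : ((n : ℕ) → (∃[ m ] (n ≡ 5 * m) ⊎ ∃[ m ] (n ≡ 5 * m + 2)) → HasOutcome (2 ∷ 3 ∷ []) n 𝓛)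
    × HasOutcome (2 ∷ 3 ∷ []) 1 𝓡
    × ((n : ℕ) → (∃[ m ] (n ≡ 5 * m + 3) ⊎ ∃[ m ] (n ≡ 5 * m + 4)) → HasOutcome (2 ∷ 3 ∷ []) n 𝓝)
    × ((m : ℕ) → HasOutcome (2 ∷ 3 ∷ []) (5 * suc m + 1) 𝓟)
proposition3 = outcome-𝓛 , outcome-1 , outcome-𝓝 , outcome-𝓟
  where
  open Block
  outcome-𝓛 : (n : ℕ) → (∃[ m ] (n ≡ 5 * m) ⊎ ∃[ m ] (n ≡ 5 * m + 2)) → HasOutcome S n 𝓛
  outcome-𝓛 _ (inj₁ (m , refl)) = at0 (block m)
  outcome-𝓛 _ (inj₂ (m , refl)) = offset-comm 𝓛 2 (5 * m) (at2 (block m))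
  outcome-𝓝 : (n : ℕ) → (∃[ m ] (n ≡ 5 * m + 3) ⊎ ∃[ m ] (n ≡ 5 * m + 4)) → HasOutcome S n 𝓝
  outcome-𝓝 _ (inj₁ (m , refl)) = offset-comm 𝓝 3 (5 * m) (at3 (block m))
  outcome-𝓝 _ (inj₂ (m , refl)) = offset-comm 𝓝 4 (5 * m) (at4 (block m))
  outcome-𝓟 : (m : ℕ) → HasOutcome S (5 * suc m + 1) 𝓟
  outcome-𝓟 m = offset-comm 𝓟 1 (5 * suc m)
    (subst (λ p → HasOutcome S (1 + p) 𝓟) (sym (*-suc 5 m)) (block-𝓟 (block m)))
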